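{- Let $k\ge1$ and $n>k$ be integers, and let $0\le i\le n-k-1$. The number of truncated level-$(k,i)$ unified diagrams for $\mathrm{Car}^{(k)}_{n+1}$ equals $$T_k(n-k-1,i)=(n-k)^{i-1}\binom{k(n-k)+n-k-2-i}{n-k-1-i}.$$
   Context: Let $M=(k+1)(n-k)-2$ and let $\mathbf t=(t_1,\ldots,t_n)$ with $t_j=n-k$ for $1\le j\le k-1$, $t_k=n-k-1$, $t_j=1$ for $k+1\le j\le n-1$, $t_n=0$ (this is the vector of out-degrees minus one of $\mathrm{Car}^{(k)}_{n+1}$, the graph on $\{1,\ldots,n+1\}$ with edges $(i,i+1),(i,k+1),\ldots,(i,n)$ for $i\le k$ and $(i,i+1),(i,n+1)$ for $k+1\le i\le n$). Put $T_j=t_1+\cdots+t_j$. A truncated level-$(k,i)$ unified diagram is a triple $(\mathbf q,\kappa,\Gamma)$ where: (1) $\mathbf q=(q_{k+1},\ldots,q_n)$ is a weak composition of $i$ such that $(M-i)+q_{k+1}+\cdots+q_j\ge T_j$ for every $k\le j\le n$; (2) $\kappa$ is an ordered set partition $(B_{k+1},\ldots,B_n)$ of $\{1,\ldots,i\}$ with $|B_j|=q_j$ (equivalently, a labeling of the north steps of the path $N^{q_{k+1}}E\cdots N^{q_n}E$ by $1,\ldots,i$, increasing along consecutive north steps); (3) $\Gamma$ is a multiset of exactly $n-k-1-i$ pairs $(\ell,h)$ with $1\le \ell\le k$ and $0\le h\le n-k-2$ (the pair $(\ell,h)$ encodes the root $\alpha_\ell+\alpha_{\ell+1}+\cdots+\alpha_{k+h}$,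 a horizontal line segment of a gravity diagram from column $\ell$ to column $k+h$), such that for every $k+1\le j\le n-2$ the number of elements $(\ell,h)$ of $\Gamma$ (with multiplicity) having $k+h\ge j$ is at most $(M-i)+q_{k+1}+\cdots+q_j-T_j$. -}

module Defs where

open import Data.Nat using (ℕ; zero; suc; _+_; _*_; _∸_; _≤_; _<ᵇ_; _≡ᵇ_)
open import Data.Bool using (if_then_else_)
open import Data.Fin using (Fin) renaming (_≟_ to _≟ᶠ_)
open import Data.Vec using (Vec; lookup; toList)
open import Data.Nat.ListAction using (sum)
open import Data.List using (List; take; drop; filter; length; map)
open import Data.Product using (_×_; _,_)
open import Relation.Binary.PropositionalEquality using (_≡_)

-- t k n j : the j-th entry (1 ≤ j ≤ n) of the vector t of out-degrees minus one
-- of Car^(k)_{n+1}:  n-k for j ≤ k-1, n-k-1 for j = k, 1 for k+1 ≤ j ≤ n-1, 0 for j = n.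
t : ℕ → ℕ → ℕ → ℕ
t k n j = if j <ᵇ k then n ∸ k
          else if j ≡ᵇ k then n ∸ k ∸ 1
          else if j <ᵇ n then 1
          else 0

T : ℕ → ℕ → ℕ → ℕ
T k n zero    = 0
T k n (suc j) = T k n j + t k n (suc j)

M : ℕ → ℕ → ℕ
M k n = (suc k) * (n ∸ k) ∸ 2

-- q_{k+1} + ... + q_{k+j}, where the vector q is indexed so that
-- position 0 holds q_{k+1}, ..., position n-k-1 holds q_n.
prefixSum : {m : ℕ} → ℕ → Vec ℕ m → ℕ
prefixSum j q = sum (take j (toList q))

-- The raw data of a triple (q, κ, Γ) for parameters k, n, i:
--  * q : Vec ℕ (n-k), entry r is q_{k+1+r};
--  * κ : Vec (Fin (n-k)) i, entry a is the index r of the block B_{k+1+r}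
--        containing the label a+1 (this is an ordered set partition of {1..i});
--  * Γ : Vec (Vec ℕ (n-k-1)) k, a multiset of pairs (ℓ,h), 1 ≤ ℓ ≤ k,
--        0 ≤ h ≤ n-k-2, given by multiplicities: entry [ℓ-1][h] is the
--        multiplicity of (ℓ,h).
Data : ℕ → ℕ → ℕ → Set
Data k n i = Vec ℕ (n ∸ k) × Vec (Fin (n ∸ k)) i × Vec (Vec ℕ (n ∸ k ∸ 1)) k

blockSize : {m i : ℕ} → Vec (Fin m) i → Fin m → ℕ
blockSize κ r = length (filter (_≟ᶠ r) (toList κ))

sizeΓ : {m k : ℕ} → Vec (Vec ℕ m) k → ℕ
sizeΓ Γ = sum (map (λ row → sum (toList row)) (toList Γ))

tailΓ : {m k : ℕ} → ℕ → Vec (Vec ℕ m) k → ℕ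
tailΓ j Γ = sum (map (λ row → sum (drop j (toList row))) (toList Γ))

-- (q, κ, Γ) is a truncated level-(k,i) unified diagram for Car^(k)_{n+1}.
-- Indices: the paper's j ranges are rewritten with j = k + j'.
IsDiagram : (k n i : ℕ) → Data k n i → Set
IsDiagram k n i (q , κ , Γ) =
    sum (toList q) ≡ i
  × (∀ j′ → j′ ≤ n ∸ k → T k n (k + j′) ≤ (M k n ∸ i) + prefixSum j′ q)
  × (∀ (r : Fin (n ∸ k)) → blockSize κ r ≡ lookup q r)
  × sizeΓ Γ ≡ n ∸ k ∸ 1 ∸ i
  × (∀ j′ → 1 ≤ j′ → k + j′ ≤ n ∸ 2 →
       tailΓ j′ Γ ≤ ((M k n ∸ i) + prefixSum j′ q) ∸ T k n (k + j′))

-- Write m = n − k and g = n − k − 1 − i, and allow Γ the extra column h = n − k − 1. There are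
-- m^i · C(km − 1 + g, g) pairs (κ, Γ) of a labelling κ : {1,…,i} → {1,…,m} (label a lies in the
-- block B_{k+κ(a)}) and a k × m multiplicity matrix Γ of total g. Their column contents
-- c_r = |κ⁻¹(r)| + Σ_ℓ Γ_{ℓr} add up to i + g = m − 1, so by the cycle lemma exactly one of the m
-- cyclic rotations of the columns makes every proper prefix sum c_1 + ⋯ + c_j at least j. Rotating
-- the columns permutes the pairs, hence exactly a 1/m fraction of them have this property. Since
-- T_{k+j} = T_k + j for j < m, these are precisely the truncated diagrams with q the block sizes of κ
-- (the extra column of Γ is forced to vanish), and km − 1 + g = k(n − k) + (n − k) − 2 − i.

module Submission where

open import Defs
open import Data.Bool using (true; false; if_then_else_)
open import Data.Bool.Properties using (T-≡; ¬-not)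
open import Data.Empty using (⊥-elim)
open import Data.Fin using (Fin; fromℕ; inject₁) renaming (zero to fzero; suc to fsuc; _≟_ to _≟ᶠ_)
open import Data.Fin.Relation.Unary.Top using (view; ‵fromℕ; ‵inject₁; view-fromℕ; view-inject₁)
open import Data.List
  using (List; []; _∷_; _++_; length; map; filter; take; drop; upTo; allFin; cartesianProductWith; cartesianProduct)
import Data.List.Properties as List
open import Data.List.Membership.Propositional using (_∈_)
open import Data.List.Membership.Propositional.Properties
  using (∈-map⁺; ∈-map⁻; ∈-++⁺ˡ; ∈-++⁺ʳ; ∈-++⁻; ∈-allFin; ∈-filter⁺; ∈-filter⁻; ∈-upTo⁺; ∈-upTo⁻; ∈-lookup;
         ∈-cartesianProductWith⁺; ∈-cartesianProduct⁺; ∈-cartesianProduct⁻)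
open import Data.List.Membership.Propositional.Properties.WithK using (unique∧set⇒bag)
open import Data.List.Relation.Binary.BagAndSetEquality using (∼bag⇒↭)
open import Data.List.Relation.Binary.Permutation.Propositional.Properties using (↭-length)
open import Data.List.Relation.Unary.All using ([]; _∷_)
import Data.List.Relation.Unary.All as All
open import Data.List.Relation.Unary.AllPairs using ([]; _∷_)
open import Data.List.Relation.Unary.Any using (here; there)
import Data.List.Relation.Unary.Any as Any
open import Data.List.Relation.Unary.Any.Properties using (lookup-index)
open import Data.List.Relation.Unary.Unique.Propositional using (Unique)
open import Data.List.Relation.Unary.Unique.Propositional.Properties
  using (map⁺; map⁻; ++⁺; filter⁺; upTo⁺; allFin⁺; cartesianProductWith⁺; cartesianProduct⁺)
open import Data.Nat using (ℕ; zero; suc; _+_; _*_; _∸_; _^_; _⊓_; _≤_; _<_; z≤n; s≤s; _≤?_; _<?_; _<ᵇ_; _≡ᵇ_)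
open import Data.Nat.Combinatorics using (_C_; nCk+nC[k+1]≡[n+1]C[k+1]; nCn≡1)
open import Data.Nat.ListAction using (sum)
open import Data.Nat.ListAction.Properties using (sum-++)
open import Data.Nat.Properties
open import Data.Nat.Solver using (module +-*-Solver)
open import Data.Product using (Σ; ∃; _×_; _,_; proj₁; proj₂)
open import Data.Sum using (inj₁; inj₂)
open import Data.Vec using (Vec; []; _∷_; toList; tabulate; lookup; concat; group; _∷ʳ_; init; last; initLast)
import Data.Vec as Vec
import Data.Vec.Properties as Vec
open import Function.Base using (_∘_)
open import Function.Bundles using (_⇔_; mk⇔; Equivalence)
open import Function.Definitions using (Injective)
open import Relation.Binary using (tri<; tri≈; tri>)
open import Relation.Binary.PropositionalEquality
open import Relation.Nullary using (Dec; yes; no; does; ¬_)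
open import Relation.Nullary.Decidable using (_→-dec_)
open import Relation.Unary using (Pred; Decidable)

open +-*-Solver using (solve; _:=_; _:+_; _:*_; con)

private variable
  A B : Set

iter : (A → A) → ℕ → A → A
iter f zero    = λ x → x
iter f (suc d) = λ x → f (iter f d x)

iter-suc′ : (f : A → A) (d : ℕ) (x : A) → iter f (suc d) x ≡ iter f d (f x)
iter-suc′ f zero    x = refl
iter-suc′ f (suc d) x = cong f (iter-suc′ f d x)

iter-inverseˡ : (f g : A → A) → (∀ a → f (g a) ≡ a) → ∀ d a → iter f d (iter g d a) ≡ a
iter-inverseˡ f g f∘g zero    a = refl
iter-inverseˡ f g f∘g (suc d) a = begin
  iter f (suc d) (g (iter g d a)) ≡⟨ iter-suc′ f d _ ⟩
  iter f d (f (g (iter g d a)))   ≡⟨ cong (iter f d) (f∘g _) ⟩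
  iter f d (iter g d a)           ≡⟨ iter-inverseˡ f g f∘g d a ⟩
  a                               ∎
  where open ≡-Reasoning

iter-injective : (f g : A → A) → (∀ a → g (f a) ≡ a) → ∀ d {x y} → iter f d x ≡ iter f d y → x ≡ y
iter-injective f g g∘f d {x} {y} eq =
  trans (sym (iter-inverseˡ g f g∘f d x)) (trans (cong (iter g d) eq) (iter-inverseˡ g f g∘f d y))

iter-invariant : (f : A → A) (φ : A → ℕ) → (∀ a → φ (f a) ≡ φ a) → ∀ d a → φ (iter f d a) ≡ φ a
iter-invariant f φ φ∘f zero    a = refl
iter-invariant f φ φ∘f (suc d) a = trans (φ∘f _) (iter-invariant f φ φ∘f d a)

unique∧set⇒length≡ : {xs ys : List A} → Unique xs → Unique ys →
  (∀ {z} → z ∈ xs ⇔ z ∈ ys) → length xs ≡ length ys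
unique∧set⇒length≡ ux uy xs≈ys = ↭-length (∼bag⇒↭ (unique∧set⇒bag ux uy xs≈ys))

Enumeration : (A → Set) → ℕ → Set
Enumeration {A} P N = Σ (Fin N → A) λ f → Injective _≡_ _≡_ f × (∀ x → P x ⇔ ∃ λ b → f b ≡ x)

lookup-enumeration : {xs : List A} → Unique xs → Enumeration (_∈ xs) (length xs)
lookup-enumeration {xs = xs} unique = Data.List.lookup xs , lookup-injective xs unique , λ x →
  mk⇔ (λ x∈ → Any.index x∈ , sym (lookup-index x∈)) (λ { (b , refl) → ∈-lookup b })
  where
  lookup-injective : ∀ xs → Unique xs → Injective _≡_ _≡_ (Data.List.lookup xs)
  lookup-injective (x ∷ xs) unique {fzero}  {fzero}  _  = refl
  lookup-injective (x ∷ xs) (x∉ ∷ _) {fzero}  {fsuc b} eq = ⊥-elim (All.lookup x∉ (∈-lookup b) eq)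
  lookup-injective (x ∷ xs) (x∉ ∷ _) {fsuc b} {fzero}  eq = ⊥-elim (All.lookup x∉ (∈-lookup b) (sym eq))
  lookup-injective (x ∷ xs) (_ ∷ unique) {fsuc b} {fsuc c} eq = cong fsuc (lookup-injective xs unique eq)

enumeration-resp-⇔ : {P Q : A → Set} {N : ℕ} → (∀ x → P x ⇔ Q x) → Enumeration Q N → Enumeration P N
enumeration-resp-⇔ P⇔Q (f , f-injective , f-onto) = f , f-injective , λ x →
  mk⇔ (Equivalence.to (f-onto x) ∘ Equivalence.to (P⇔Q x)) (Equivalence.from (P⇔Q x) ∘ Equivalence.from (f-onto x))

sum-map-const : (c : ℕ) (xs : List A) → sum (map (λ _ → c) xs) ≡ length xs * c
sum-map-const c []       = refl
sum-map-const c (x ∷ xs) = cong (c +_) (sum-map-const c xs)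

sum-map-cong : {f g : A → ℕ} (xs : List A) → (∀ {x} → x ∈ xs → f x ≡ g x) → sum (map f xs) ≡ sum (map g xs)
sum-map-cong []       f≡g = refl
sum-map-cong (x ∷ xs) f≡g = cong₂ _+_ (f≡g (here refl)) (sum-map-cong xs (f≡g ∘ there))

sum-map-+ : (f g : A → ℕ) (xs : List A) → sum (map (λ x → f x + g x) xs) ≡ sum (map f xs) + sum (map g xs)
sum-map-+ f g []       = refl
sum-map-+ f g (x ∷ xs) = trans (cong (f x + g x +_) (sum-map-+ f g xs))
  (solve 4 (λ a b c d → (a :+ b) :+ (c :+ d) := (a :+ c) :+ (b :+ d)) refl (f x) (g x) _ _)

indicator : {P : Set} → Dec P → ℕ
indicator P? = if does P? then 1 else 0

length-filter-∷ : {P : Pred A _} (P? : Decidable P) (x : A) (xs : List A) →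
  length (filter P? (x ∷ xs)) ≡ indicator (P? x) + length (filter P? xs)
length-filter-∷ P? x xs with does (P? x)
... | true  = refl
... | false = refl

length-filter-cong : {P Q : Pred A _} (P? : Decidable P) (Q? : Decidable Q) (xs : List A) →
  (∀ {x} → x ∈ xs → P x ⇔ Q x) → length (filter P? xs) ≡ length (filter Q? xs)
length-filter-cong P? Q? []       P⇔Q = refl
length-filter-cong {P = P} {Q} P? Q? (x ∷ xs) P⇔Q
  rewrite length-filter-∷ P? x xs | length-filter-∷ Q? x xs
        | length-filter-cong P? Q? xs (P⇔Q ∘ there) = cong (_+ length (filter Q? xs)) (same-indicator (P⇔Q (here refl)))
  where
  same-indicator : P x ⇔ Q x → indicator (P? x) ≡ indicator (Q? x)
  same-indicator P⇔Q with P? x | Q? x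
  ... | yes _ | yes _ = refl
  ... | no  _ | no  _ = refl
  ... | yes p | no ¬q = ⊥-elim (¬q (Equivalence.to P⇔Q p))
  ... | no ¬p | yes q = ⊥-elim (¬p (Equivalence.from P⇔Q q))

length-filter-map : (f : A → B) {P : Pred B _} (P? : Decidable P) (xs : List A) →
  length (filter P? (map f xs)) ≡ length (filter (P? ∘ f) xs)
length-filter-map f P? []       = refl
length-filter-map f P? (x ∷ xs) =
  trans (length-filter-∷ P? (f x) (map f xs))
        (trans (cong (indicator (P? (f x)) +_) (length-filter-map f P? xs)) (sym (length-filter-∷ (P? ∘ f) x xs)))

double-counting : {R : A → B → Set} (R? : ∀ d x → Dec (R d x)) (ds : List A) (xs : List B) →
  sum (map (λ d → length (filter (R? d) xs)) ds) ≡ sum (map (λ x → length (filter (λ d → R? d x) ds)) xs)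
double-counting R? ds []       = trans (sum-map-const 0 ds) (*-zeroʳ (length ds))
double-counting R? ds (x ∷ xs) = begin
  sum (map (λ d → length (filter (R? d) (x ∷ xs))) ds)
    ≡⟨ cong sum (List.map-cong (λ d → length-filter-∷ (R? d) x xs) ds) ⟩
  sum (map (λ d → indicator (R? d x) + length (filter (R? d) xs)) ds)
    ≡⟨ sum-map-+ (λ d → indicator (R? d x)) (λ d → length (filter (R? d) xs)) ds ⟩
  sum (map (λ d → indicator (R? d x)) ds) + sum (map (λ d → length (filter (R? d) xs)) ds)
    ≡⟨ cong₂ _+_ (sum-indicator ds) (double-counting R? ds xs) ⟩
  length (filter (λ d → R? d x) ds) + sum (map (λ x → length (filter (λ d → R? d x) ds)) xs) ∎
  where
  open ≡-Reasoning
  sum-indicator : ∀ ds → sum (map (λ d → indicator (R? d x)) ds) ≡ length (filter (λ d → R? d x) ds)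
  sum-indicator []       = refl
  sum-indicator (d ∷ ds) = trans (cong (indicator (R? d x) +_) (sum-indicator ds))
                                 (sym (length-filter-∷ (λ d → R? d x) d ds))

length-cartesianProductWith : {C : Set} (f : A → B → C) (xs : List A) (ys : List B) →
  length (cartesianProductWith f xs ys) ≡ length xs * length ys
length-cartesianProductWith f []       ys = refl
length-cartesianProductWith f (x ∷ xs) ys = trans (List.length-++ (map (f x) ys))
  (cong₂ _+_ (List.length-map (f x) ys) (length-cartesianProductWith f xs ys))

take-+ : ∀ a b (xs : List A) → take (a + b) xs ≡ take a xs ++ take b (drop a xs)
take-+ zero    b xs       = refl
take-+ (suc a) b []       = sym (List.take-[] b)
take-+ (suc a) b (x ∷ xs) = cong (x ∷_) (take-+ a b xs)

take-++ˡ : ∀ j (xs ys : List A) → j ≤ length xs → take j (xs ++ ys) ≡ take j xs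
take-++ˡ zero    xs       ys _         = refl
take-++ˡ (suc j) (x ∷ xs) ys (s≤s j≤n) = cong (x ∷_) (take-++ˡ j xs ys j≤n)

take-++ʳ : ∀ b (xs ys : List A) → take (length xs + b) (xs ++ ys) ≡ xs ++ take b ys
take-++ʳ b []       ys = refl
take-++ʳ b (x ∷ xs) ys = cong (x ∷_) (take-++ʳ b xs ys)

drop-++ʳ : (xs ys : List A) → drop (length xs) (xs ++ ys) ≡ ys
drop-++ʳ []       ys = refl
drop-++ʳ (x ∷ xs) ys = drop-++ʳ xs ys

map-inverse : ∀ {m} (f : B → A) (g : A → B) → (∀ a → f (g a) ≡ a) → (v : Vec A m) → Vec.map f (Vec.map g v) ≡ v
map-inverse f g f∘g v = trans (sym (Vec.map-∘ f g v)) (trans (Vec.map-cong f∘g v) (Vec.map-id v))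

≤-⇔-shift : ∀ a c {m n m′ n′} → a + m ≡ m′ + c → a + n ≡ n′ + c → (m ≤ n ⇔ m′ ≤ n′)
≤-⇔-shift a c {m} {n} {m′} {n′} eqₘ eqₙ = mk⇔
  (λ m≤n → +-cancelʳ-≤ c m′ n′ (subst₂ _≤_ eqₘ eqₙ (+-monoʳ-≤ a m≤n)))
  (λ m′≤n′ → +-cancelˡ-≤ a m n (subst₂ _≤_ (sym eqₘ) (sym eqₙ) (+-monoˡ-≤ c m′≤n′)))

rotate : ℕ → List A → List A
rotate d xs = drop d xs ++ take d xs

length-rotate : ∀ d (xs : List A) → length (rotate d xs) ≡ length xs
length-rotate d xs = begin
  length (drop d xs ++ take d xs)       ≡⟨ List.length-++ (drop d xs) ⟩
  length (drop d xs) + length (take d xs) ≡⟨ cong₂ _+_ (List.length-drop d xs) (List.length-take d xs) ⟩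
  (length xs ∸ d) + (d ⊓ length xs)     ≡⟨ +-comm (length xs ∸ d) _ ⟩
  (d ⊓ length xs) + (length xs ∸ d)     ≡⟨ m⊓n+n∸m≡n d (length xs) ⟩
  length xs                             ∎
  where open ≡-Reasoning

rotate-suc : ∀ d (xs : List A) → d < length xs → rotate 1 (rotate d xs) ≡ rotate (suc d) xs
rotate-suc d xs d<n with drop d xs in eq
... | []       = ⊥-elim (<⇒≱ d<n (m∸n≡0⇒m≤n (trans (sym (List.length-drop d xs)) (cong length eq))))
... | a ∷ rest = begin
  (rest ++ take d xs) ++ a ∷ [] ≡⟨ List.++-assoc rest (take d xs) (a ∷ []) ⟩
  rest ++ (take d xs ++ a ∷ []) ≡⟨ cong₂ _++_ drop-suc take-suc ⟩
  drop (suc d) xs ++ take (suc d) xs ∎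
  where
  open ≡-Reasoning
  drop-suc : rest ≡ drop (suc d) xs
  drop-suc = trans (cong (drop 1) (sym eq)) (trans (List.drop-drop d 1 xs) (cong (λ e → drop e xs) (+-comm d 1)))
  take-suc : take d xs ++ a ∷ [] ≡ take (suc d) xs
  take-suc = trans (cong (λ ys → take d xs ++ take 1 ys) (sym eq))
                   (trans (sym (take-+ d 1 xs)) (cong (λ e → take e xs) (+-comm d 1)))

module _ (xs : List ℕ) where
  private
    S : ℕ → ℕ
    S a = sum (take a xs)
    n = length xs

  sum-take-rotate-inner : ∀ d j → d + j ≤ n → sum (take j (rotate d xs)) + S d ≡ S (d + j)
  sum-take-rotate-inner d j d+j≤n = begin
    sum (take j (drop d xs ++ take d xs)) + S d ≡⟨ cong (λ ys → sum ys + S d) (take-++ˡ j (drop d xs) (take d xs) j≤) ⟩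
    sum (take j (drop d xs)) + S d             ≡⟨ +-comm _ (S d) ⟩
    S d + sum (take j (drop d xs))             ≡⟨ sym (sum-++ (take d xs) (take j (drop d xs))) ⟩
    sum (take d xs ++ take j (drop d xs))      ≡⟨ cong sum (sym (take-+ d j xs)) ⟩
    S (d + j)                                  ∎
    where
    open ≡-Reasoning
    j≤ : j ≤ length (drop d xs)
    j≤ = subst (j ≤_) (sym (List.length-drop d xs)) (subst (_≤ n ∸ d) (m+n∸m≡n d j) (∸-monoˡ-≤ d d+j≤n))

  sum-take-rotate-wrapped : ∀ d j → n ≤ d + j → d ≤ n → j ≤ n →
    sum (take j (rotate d xs)) + S d ≡ sum xs + S (d + j ∸ n)
  sum-take-rotate-wrapped d j n≤d+j d≤n j≤n = begin
    sum (take j (drop d xs ++ take d xs)) + S d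
      ≡⟨ cong (λ e → sum (take e (drop d xs ++ take d xs)) + S d) j≡ ⟩
    sum (take (length (drop d xs) + b) (drop d xs ++ take d xs)) + S d
      ≡⟨ cong (λ ys → sum ys + S d) (take-++ʳ b (drop d xs) (take d xs)) ⟩
    sum (drop d xs ++ take b (take d xs)) + S d
      ≡⟨ cong (λ ys → sum (drop d xs ++ ys) + S d) take-take-b ⟩
    sum (drop d xs ++ take b xs) + S d
      ≡⟨ cong (_+ S d) (sum-++ (drop d xs) (take b xs)) ⟩
    (sum (drop d xs) + S b) + S d
      ≡⟨ solve 3 (λ x y z → (x :+ y) :+ z := (z :+ x) :+ y) refl (sum (drop d xs)) (S b) (S d) ⟩
    (S d + sum (drop d xs)) + S b
      ≡⟨ cong (_+ S b) (trans (sym (sum-++ (take d xs) (drop d xs))) (cong sum (List.take++drop≡id d xs))) ⟩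
    sum xs + S b ∎
    where
    open ≡-Reasoning
    b = d + j ∸ n
    j≡ : j ≡ length (drop d xs) + b
    j≡ = begin
      j                   ≡⟨ sym (m+n∸m≡n d j) ⟩
      d + j ∸ d           ≡⟨ cong (_∸ d) (sym (m∸n+n≡m n≤d+j)) ⟩
      b + n ∸ d           ≡⟨ +-∸-assoc b d≤n ⟩
      b + (n ∸ d)         ≡⟨ +-comm b (n ∸ d) ⟩
      (n ∸ d) + b         ≡⟨ cong (_+ b) (sym (List.length-drop d xs)) ⟩
      length (drop d xs) + b ∎
    b≤d : b ≤ d
    b≤d = subst (b ≤_) (m+n∸n≡m d n) (∸-monoˡ-≤ n (+-monoʳ-≤ d j≤n))
    take-take-b : take b (take d xs) ≡ take b xs
    take-take-b = trans (List.take-take b d xs) (cong (λ e → take e xs) (m≤n⇒m⊓n≡m b≤d))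

Dominating : List ℕ → Set
Dominating xs = ∀ {j} → j < length xs → 1 ≤ j → j ≤ sum (take j xs)

dominating? : ∀ xs → Dec (Dominating xs)
dominating? xs = allUpTo? (λ j → (1 ≤? j) →-dec (j ≤? sum (take j xs))) (length xs)

module CycleLemma (xs : List ℕ) {L : ℕ} (length≡ : length xs ≡ suc L) (sum≡ : sum xs ≡ L) where

  private
    S : ℕ → ℕ
    S a = sum (take a xs)

    P : ℕ → ℕ → ℕ
    P d j = sum (take j (rotate d xs))

  -- a ≼ b and a ≺ b compare S a − a with S b − b, with the subtractions moved across.
  _≼_ _≺_ : ℕ → ℕ → Set
  a ≼ b = S a + b ≤ S b + a
  a ≺ b = S a + b < S b + a

  _≺?_ : ∀ a b → Dec (a ≺ b)
  a ≺? b = S a + b <? S b + a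

  ≺-≼-trans : ∀ {a b c} → a ≺ b → b ≼ c → a ≺ c
  ≺-≼-trans {a} {b} {c} a≺b b≼c = +-cancelʳ-< (S b + b) (S a + c) (S c + a)
    (subst₂ _<_ (solve 5 (λ x y z u v → (x :+ y) :+ (z :+ u) := (x :+ u) :+ (z :+ y)) refl (S a) b (S b) c (S c))
                (solve 5 (λ x y z u v → (z :+ x) :+ (v :+ y) := (v :+ x) :+ (z :+ y)) refl a b (S b) c (S c))
                (+-mono-<-≤ a≺b b≼c))

  ≺-trans : ∀ {a b c} → a ≺ b → b ≺ c → a ≺ c
  ≺-trans {a} {b} {c} a≺b b≺c = ≺-≼-trans {a} {b} {c} a≺b (<⇒≤ b≺c)

  -- d is the first point of [0, L] at which S a − a attains its minimum.
  FirstMinimiser : ℕ → Set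
  FirstMinimiser d = (∀ c → d < c → c ≤ L → d ≼ c) × (∀ b → b < d → d ≺ b)

  inner-prefix⇔ : ∀ {d j c} → d + j ≡ c → c ≤ L → (j ≤ P d j ⇔ d ≼ c)
  inner-prefix⇔ {d} {j} {c} refl c≤L = ≤-⇔-shift (S d + d) 0
    (solve 3 (λ x y z → (x :+ y) :+ z := (x :+ (y :+ z)) :+ con 0) refl (S d) d j)
    (begin
      (S d + d) + P d j ≡⟨ solve 3 (λ x y z → (x :+ y) :+ z := (z :+ x) :+ y) refl (S d) d (P d j) ⟩
      (P d j + S d) + d ≡⟨ cong (_+ d) (sum-take-rotate-inner xs d j (subst (c ≤_) (sym length≡) (m≤n⇒m≤1+n c≤L))) ⟩
      S c + d           ≡⟨ sym (+-identityʳ _) ⟩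
      (S c + d) + 0     ∎)
    where open ≡-Reasoning

  wrapped-prefix⇔ : ∀ {d j b} → j + d ≡ b + suc L → b < d → d ≤ L → (j ≤ P d j ⇔ d ≺ b)
  wrapped-prefix⇔ {d} {j} {b} j+d≡ b<d d≤L = ≤-⇔-shift (S d + d) L
    (begin
      (S d + d) + j     ≡⟨ solve 3 (λ x y z → (x :+ y) :+ z := x :+ (z :+ y)) refl (S d) d j ⟩
      S d + (j + d)     ≡⟨ cong (S d +_) j+d≡ ⟩
      S d + (b + suc L) ≡⟨ solve 3 (λ x y z → x :+ (y :+ (con 1 :+ z)) := (con 1 :+ (x :+ y)) :+ z) refl (S d) b L ⟩
      suc (S d + b) + L ∎)
    (begin
      (S d + d) + P d j ≡⟨ solve 3 (λ x y z → (x :+ y) :+ z := (z :+ x) :+ y) refl (S d) d (P d j) ⟩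
      (P d j + S d) + d ≡⟨ cong (_+ d) (trans (sum-take-rotate-wrapped xs d j n≤d+j d≤n j≤n) (cong (_+ _) sum≡)) ⟩
      (L + S (d + j ∸ length xs)) + d ≡⟨ cong (λ e → (L + S e) + d) d+j∸n≡b ⟩
      (L + S b) + d     ≡⟨ solve 3 (λ x y z → (x :+ y) :+ z := (y :+ z) :+ x) refl L (S b) d ⟩
      (S b + d) + L     ∎)
    where
    open ≡-Reasoning
    j+d≡b+n : j + d ≡ b + length xs
    j+d≡b+n = trans j+d≡ (cong (b +_) (sym length≡))
    d+j≡ : d + j ≡ b + length xs
    d+j≡ = trans (+-comm d j) j+d≡b+n
    n≤d+j : length xs ≤ d + j
    n≤d+j = subst (length xs ≤_) (sym d+j≡) (m≤n+m (length xs) b)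
    d+j∸n≡b : d + j ∸ length xs ≡ b
    d+j∸n≡b = trans (cong (_∸ length xs) d+j≡) (m+n∸n≡m b (length xs))
    d≤n : d ≤ length xs
    d≤n = subst (d ≤_) (sym length≡) (m≤n⇒m≤1+n d≤L)
    j≤n : j ≤ length xs
    j≤n = +-cancelʳ-≤ d j (length xs)
      (subst₂ _≤_ (sym j+d≡b+n) (+-comm d (length xs)) (+-monoˡ-≤ (length xs) (<⇒≤ b<d)))

  dominating⇒firstMinimiser : ∀ {d} → d ≤ L → Dominating (rotate d xs) → FirstMinimiser d
  dominating⇒firstMinimiser {d} d≤L dominating = inner , wrapped
    where
    holds : ∀ {j} → j ≤ L → 1 ≤ j → j ≤ P d j
    holds j≤L = dominating (subst (_ <_) (sym (trans (length-rotate d xs) length≡)) (s≤s j≤L))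
    inner : ∀ c → d < c → c ≤ L → d ≼ c
    inner c d<c c≤L = Equivalence.to (inner-prefix⇔ (m+[n∸m]≡n (<⇒≤ d<c)) c≤L)
                                     (holds (≤-trans (m∸n≤m c d) c≤L) (m<n⇒0<n∸m d<c))
    wrapped : ∀ b → b < d → d ≺ b
    wrapped b b<d = Equivalence.to (wrapped-prefix⇔ (m∸n+n≡m (<⇒≤ d<b+n)) b<d d≤L) (holds j≤L (m<n⇒0<n∸m d<b+n))
      where
      d<b+n : d < b + suc L
      d<b+n = <-≤-trans (s≤s d≤L) (m≤n+m (suc L) b)
      j≤L : b + suc L ∸ d ≤ L
      j≤L = subst (b + suc L ∸ d ≤_) (trans (cong (_∸ suc b) (+-suc b L)) (m+n∸m≡n (suc b) L)) (∸-monoʳ-≤ (b + suc L) b<d)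

  firstMinimiser⇒dominating : ∀ {d} → d ≤ L → FirstMinimiser d → Dominating (rotate d xs)
  firstMinimiser⇒dominating {d} d≤L (inner , wrapped) {j} j<n 1≤j with d + j ≤? L
  ... | yes d+j≤L = Equivalence.from (inner-prefix⇔ refl d+j≤L) (inner (d + j) (m<m+n d 1≤j) d+j≤L)
  ... | no  d+j≰L = Equivalence.from (wrapped-prefix⇔ j+d≡b+n b<d d≤L) (wrapped b b<d)
    where
    b = d + j ∸ suc L
    b+n≡d+j : b + suc L ≡ d + j
    b+n≡d+j = m∸n+n≡m (≰⇒> d+j≰L)
    j+d≡b+n : j + d ≡ b + suc L
    j+d≡b+n = trans (+-comm j d) (sym b+n≡d+j)
    b<d : b < d
    b<d = +-cancelʳ-< (suc L) b d
      (subst₂ _<_ (sym b+n≡d+j) refl (+-monoʳ-< d (subst (j <_) (trans (length-rotate d xs) length≡) j<n)))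

  firstMinimiser-upTo : ∀ k → ∃ λ a → a ≤ k × (∀ c → a < c → c ≤ k → a ≼ c) × (∀ b → b < a → a ≺ b)
  firstMinimiser-upTo zero = 0 , z≤n , (λ c 0<c c≤0 → ⊥-elim (<⇒≱ 0<c c≤0)) , (λ b ())
  firstMinimiser-upTo (suc k) with firstMinimiser-upTo k
  ... | a , a≤k , inner , wrapped with suc k ≺? a
  ...   | yes k+1≺a = suc k , ≤-refl , (λ c k+1<c c≤k+1 → ⊥-elim (<⇒≱ k+1<c c≤k+1)) , wrapped′
    where
    wrapped′ : ∀ b → b < suc k → suc k ≺ b
    wrapped′ b (s≤s b≤k) with <-cmp b a
    ... | tri< b<a _ _    = ≺-trans {suc k} {a} {b} k+1≺a (wrapped b b<a)
    ... | tri≈ _ refl _   = k+1≺a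
    ... | tri> _ _ a<b    = ≺-≼-trans {suc k} {a} {b} k+1≺a (inner b a<b b≤k)
  ...   | no k+1⊀a = a , m≤n⇒m≤1+n a≤k , inner′ , wrapped
    where
    inner′ : ∀ c → a < c → c ≤ suc k → a ≼ c
    inner′ c a<c c≤k+1 with m≤n⇒m<n∨m≡n c≤k+1
    ... | inj₁ (s≤s c≤k) = inner c a<c c≤k
    ... | inj₂ refl      = ≮⇒≥ k+1⊀a

  firstMinimiser-unique : ∀ {d d′} → d ≤ L → d′ ≤ L → FirstMinimiser d → FirstMinimiser d′ → d ≡ d′
  firstMinimiser-unique {d} {d′} d≤L d′≤L (inner , wrapped) (inner′ , wrapped′) with <-cmp d d′
  ... | tri≈ _ d≡d′ _ = d≡d′
  ... | tri< d<d′ _ _ = ⊥-elim (<⇒≱ (wrapped′ d d<d′) (inner d′ d<d′ d′≤L))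
  ... | tri> _ _ d′<d = ⊥-elim (<⇒≱ (wrapped d′ d′<d) (inner′ d d′<d d≤L))

  exactly-one-dominating-rotation : length (filter (λ d → dominating? (rotate d xs)) (upTo (suc L))) ≡ 1
  exactly-one-dominating-rotation with firstMinimiser-upTo L
  ... | a , a≤L , minimiser =
    unique∧set⇒length≡ (filter⁺ (λ d → dominating? (rotate d xs)) (upTo⁺ (suc L))) ([] ∷ []) (mk⇔ only-a a-in)
    where
    only-a : ∀ {d} → d ∈ filter (λ d → dominating? (rotate d xs)) (upTo (suc L)) → d ∈ a ∷ []
    only-a d∈ with ∈-filter⁻ (λ d → dominating? (rotate d xs)) d∈
    ... | d∈upTo , dominating = here (firstMinimiser-unique d≤L a≤L (dominating⇒firstMinimiser d≤L dominating) minimiser)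
      where d≤L = ≤-pred (∈-upTo⁻ d∈upTo)
    a-in : ∀ {d} → d ∈ a ∷ [] → d ∈ filter (λ d → dominating? (rotate d xs)) (upTo (suc L))
    a-in (here refl) =
      ∈-filter⁺ (λ d → dominating? (rotate d xs)) (∈-upTo⁺ (s≤s a≤L)) (firstMinimiser⇒dominating a≤L minimiser)

allVecs : (m i : ℕ) → List (Vec (Fin m) i)
allVecs m zero    = [] ∷ []
allVecs m (suc i) = cartesianProductWith _∷_ (allFin m) (allVecs m i)

∈-allVecs : ∀ {m i} (v : Vec (Fin m) i) → v ∈ allVecs m i
∈-allVecs []      = here refl
∈-allVecs (a ∷ v) = ∈-cartesianProductWith⁺ _∷_ (∈-allFin a) (∈-allVecs v)

allVecs⁺ : ∀ m i → Unique (allVecs m i)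
allVecs⁺ m zero    = [] ∷ []
allVecs⁺ m (suc i) = cartesianProductWith⁺ _∷_ Vec.∷-injective (allFin⁺ m) (allVecs⁺ m i)

length-allVecs : ∀ m i → length (allVecs m i) ≡ m ^ i
length-allVecs m zero    = refl
length-allVecs m (suc i) = trans (length-cartesianProductWith _∷_ (allFin m) (allVecs m i))
  (cong₂ _*_ (List.length-tabulate {n = m} (λ a → a)) (length-allVecs m i))

vecSum : ∀ {p} → Vec ℕ p → ℕ
vecSum v = sum (toList v)

incrementHead : ∀ {p} → Vec ℕ (suc p) → Vec ℕ (suc p)
incrementHead (a ∷ v) = suc a ∷ v

compositions : (p g : ℕ) → List (Vec ℕ p)
compositions zero    zero    = [] ∷ []
compositions zero    (suc g) = []
compositions (suc p) zero    = map (0 ∷_) (compositions p zero)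
compositions (suc p) (suc g) = map (0 ∷_) (compositions p (suc g)) ++ map incrementHead (compositions (suc p) g)

∈-compositions⁻ : ∀ p g {v : Vec ℕ p} → v ∈ compositions p g → vecSum v ≡ g
∈-compositions⁻ zero    zero    (here refl) = refl
∈-compositions⁻ (suc p) zero    v∈ with ∈-map⁻ (0 ∷_) v∈
... | w , w∈ , refl = ∈-compositions⁻ p zero w∈
∈-compositions⁻ (suc p) (suc g) v∈ with ∈-++⁻ (map (0 ∷_) (compositions p (suc g))) v∈
... | inj₁ v∈₁ with ∈-map⁻ (0 ∷_) v∈₁
...   | w , w∈ , refl = ∈-compositions⁻ p (suc g) w∈
∈-compositions⁻ (suc p) (suc g) v∈ | inj₂ v∈₂ with ∈-map⁻ incrementHead v∈₂
...   | a ∷ w , w∈ , refl = cong suc (∈-compositions⁻ (suc p) g w∈)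

∈-compositions⁺ : ∀ {p} (v : Vec ℕ p) → v ∈ compositions p (vecSum v)
∈-compositions⁺ []          = here refl
∈-compositions⁺ (zero ∷ v) with vecSum v in eq
... | zero  = ∈-map⁺ (0 ∷_) (subst (λ g → v ∈ compositions _ g) eq (∈-compositions⁺ v))
... | suc g = ∈-++⁺ˡ (∈-map⁺ (0 ∷_) (subst (λ g → v ∈ compositions _ g) eq (∈-compositions⁺ v)))
∈-compositions⁺ {suc p} (suc a ∷ v) =
  ∈-++⁺ʳ (map (0 ∷_) (compositions p _)) (∈-map⁺ incrementHead (∈-compositions⁺ (a ∷ v)))

compositions⁺ : ∀ p g → Unique (compositions p g)
compositions⁺ zero    zero    = [] ∷ []
compositions⁺ zero    (suc g) = []
compositions⁺ (suc p) zero    = map⁺ Vec.∷-injectiveʳ (compositions⁺ p zero)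
compositions⁺ (suc p) (suc g) =
  ++⁺ (map⁺ Vec.∷-injectiveʳ (compositions⁺ p (suc g))) (map⁺ incrementHead-injective (compositions⁺ (suc p) g)) disjoint
  where
  incrementHead-injective : ∀ {u v : Vec ℕ (suc p)} → incrementHead u ≡ incrementHead v → u ≡ v
  incrementHead-injective {_ ∷ _} {_ ∷ _} refl = refl
  disjoint : ∀ {v} → ¬ (v ∈ map (0 ∷_) (compositions p (suc g)) × v ∈ map incrementHead (compositions (suc p) g))
  disjoint (v∈₁ , v∈₂) with ∈-map⁻ (0 ∷_) v∈₁ | ∈-map⁻ incrementHead v∈₂
  ... | _ , _ , refl | _ ∷ _ , _ , ()

length-compositions : ∀ p g → length (compositions (suc p) g) ≡ (p + g) C g
length-compositions p       zero    = trans (List.length-map (0 ∷_) (compositions p zero)) (count-zero p)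
  where
  count-zero : ∀ p → length (compositions p zero) ≡ 1
  count-zero zero    = refl
  count-zero (suc p) = trans (List.length-map (0 ∷_) (compositions p zero)) (count-zero p)
length-compositions zero    (suc g) = begin
  length (map (0 ∷_) [] ++ map incrementHead (compositions 1 g)) ≡⟨ List.length-map incrementHead (compositions 1 g) ⟩
  length (compositions 1 g)                                    ≡⟨ length-compositions zero g ⟩
  g C g                                                        ≡⟨ trans (nCn≡1 g) (sym (nCn≡1 (suc g))) ⟩
  suc g C suc g                                                ∎
  where open ≡-Reasoning
length-compositions (suc p) (suc g) = begin
  length (map (0 ∷_) (compositions (suc p) (suc g)) ++ map incrementHead (compositions (suc (suc p)) g))
    ≡⟨ List.length-++ (map (0 ∷_) (compositions (suc p) (suc g))) ⟩
  length (map (0 ∷_) (compositions (suc p) (suc g))) + length (map incrementHead (compositions (suc (suc p)) g))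
    ≡⟨ cong₂ _+_ (List.length-map (0 ∷_) (compositions (suc p) (suc g)))
                 (List.length-map incrementHead (compositions (suc (suc p)) g)) ⟩
  length (compositions (suc p) (suc g)) + length (compositions (suc (suc p)) g)
    ≡⟨ cong₂ _+_ (length-compositions p (suc g)) (length-compositions (suc p) g) ⟩
  (p + suc g) C suc g + (suc p + g) C g
    ≡⟨ cong (λ n → n C suc g + (suc p + g) C g) (+-suc p g) ⟩
  (suc p + g) C suc g + (suc p + g) C g
    ≡⟨ +-comm ((suc p + g) C suc g) _ ⟩
  (suc p + g) C g + (suc p + g) C suc g
    ≡⟨ nCk+nC[k+1]≡[n+1]C[k+1] (suc p + g) g ⟩
  suc (suc p + g) C suc g
    ≡⟨ cong (_C suc g) (sym (+-suc (suc p) g)) ⟩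
  (suc p + suc g) C suc g ∎
  where open ≡-Reasoning

unflatten : ∀ {m} k → Vec ℕ (k * m) → Vec (Vec ℕ m) k
unflatten {m} k v = proj₁ (group k m v)

concat-unflatten : ∀ {m} k (v : Vec ℕ (k * m)) → concat (unflatten {m} k v) ≡ v
concat-unflatten {m} k v = sym (proj₂ (group k m v))

concat-injective : ∀ {m k} (Γ Δ : Vec (Vec ℕ m) k) → concat Γ ≡ concat Δ → Γ ≡ Δ
concat-injective []      []      _  = refl
concat-injective (r ∷ Γ) (s ∷ Δ) eq =
  cong₂ _∷_ (Vec.++-injectiveˡ r s eq) (concat-injective Γ Δ (Vec.++-injectiveʳ r s eq))

unflatten-concat : ∀ {m k} (Γ : Vec (Vec ℕ m) k) → unflatten k (concat Γ) ≡ Γ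
unflatten-concat {k = k} Γ = concat-injective _ Γ (concat-unflatten k (concat Γ))

unflatten-injective : ∀ {m} k {u v : Vec ℕ (k * m)} → unflatten {m} k u ≡ unflatten k v → u ≡ v
unflatten-injective k {u} {v} eq =
  trans (sym (concat-unflatten k u)) (trans (cong concat eq) (concat-unflatten k v))

vecSum-concat : ∀ {m k} (Γ : Vec (Vec ℕ m) k) → vecSum (concat Γ) ≡ sizeΓ Γ
vecSum-concat []      = refl
vecSum-concat (r ∷ Γ) = begin
  sum (toList (r Vec.++ concat Γ))       ≡⟨ cong sum (Vec.toList-++ r (concat Γ)) ⟩
  sum (toList r ++ toList (concat Γ))    ≡⟨ sum-++ (toList r) (toList (concat Γ)) ⟩
  vecSum r + vecSum (concat Γ)           ≡⟨ cong (vecSum r +_) (vecSum-concat Γ) ⟩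
  vecSum r + sizeΓ Γ                     ∎
  where open ≡-Reasoning

matrices : (k m g : ℕ) → List (Vec (Vec ℕ m) k)
matrices k m g = map (unflatten k) (compositions (k * m) g)

∈-matrices⁺ : ∀ {m k} (Γ : Vec (Vec ℕ m) k) → Γ ∈ matrices k m (sizeΓ Γ)
∈-matrices⁺ {k = k} Γ = subst (_∈ matrices _ _ (sizeΓ Γ)) (unflatten-concat Γ)
  (∈-map⁺ (unflatten k) (subst (λ g → concat Γ ∈ compositions _ g) (vecSum-concat Γ) (∈-compositions⁺ (concat Γ))))

∈-matrices⁻ : ∀ {k m g} {Γ : Vec (Vec ℕ m) k} → Γ ∈ matrices k m g → sizeΓ Γ ≡ g
∈-matrices⁻ {k} {m} {g} Γ∈ with ∈-map⁻ (unflatten k) Γ∈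
... | v , v∈ , refl = begin
  sizeΓ (unflatten k v)          ≡⟨ sym (vecSum-concat (unflatten k v)) ⟩
  vecSum (concat (unflatten k v)) ≡⟨ cong vecSum (concat-unflatten k v) ⟩
  vecSum v                        ≡⟨ ∈-compositions⁻ (k * m) g v∈ ⟩
  g                               ∎
  where open ≡-Reasoning

matrices⁺ : ∀ k m g → Unique (matrices k m g)
matrices⁺ k m g = map⁺ (unflatten-injective k) (compositions⁺ (k * m) g)

length-matrices : ∀ k′ m′ g → length (matrices (suc k′) (suc m′) g) ≡ (m′ + k′ * suc m′ + g) C g
length-matrices k′ m′ g = trans (List.length-map (unflatten (suc k′)) (compositions (suc k′ * suc m′) g))
                                (length-compositions (m′ + k′ * suc m′) g)

Config : (m i k : ℕ) → Set
Config m i k = Vec (Fin m) i × Vec (Vec ℕ m) k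

configs : (m i k g : ℕ) → List (Config m i k)
configs m i k g = cartesianProduct (allVecs m i) (matrices k m g)

∈-configs⁺ : ∀ {m i k} (x : Config m i k) → x ∈ configs m i k (sizeΓ (proj₂ x))
∈-configs⁺ (κ , Γ) = ∈-cartesianProduct⁺ (∈-allVecs κ) (∈-matrices⁺ Γ)

∈-configs⁻ : ∀ {m i k g} {x : Config m i k} → x ∈ configs m i k g → sizeΓ (proj₂ x) ≡ g
∈-configs⁻ {m} {i} {k} {g} x∈ = ∈-matrices⁻ (proj₂ (∈-cartesianProduct⁻ (allVecs m i) (matrices k m g) x∈))

configs⁺ : ∀ m i k g → Unique (configs m i k g)
configs⁺ m i k g = cartesianProduct⁺ (allVecs⁺ m i) (matrices⁺ k m g)

length-configs : ∀ m′ i k′ g → length (configs (suc m′) i (suc k′) g) ≡ suc m′ ^ i * ((m′ + k′ * suc m′ + g) C g)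
length-configs m′ i k′ g = trans (length-cartesianProductWith _,_ (allVecs (suc m′) i) (matrices (suc k′) (suc m′) g))
  (cong₂ _*_ (length-allVecs (suc m′) i) (length-matrices k′ m′ g))

colSum : ∀ {m k} → Vec (Vec ℕ m) k → Fin m → ℕ
colSum []      r = 0
colSum (row ∷ Γ) r = lookup row r + colSum Γ r

content : ∀ {m i k} → Config m i k → Vec ℕ m
content (κ , Γ) = tabulate (λ r → blockSize κ r + colSum Γ r)

prefixSum-tabulate-+ : ∀ {m} (f g : Fin m → ℕ) j →
  prefixSum j (tabulate (λ r → f r + g r)) ≡ prefixSum j (tabulate f) + prefixSum j (tabulate g)
prefixSum-tabulate-+ {zero}  f g zero    = refl
prefixSum-tabulate-+ {zero}  f g (suc j) = refl
prefixSum-tabulate-+ {suc m} f g zero    = refl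
prefixSum-tabulate-+ {suc m} f g (suc j) =
  trans (cong (f fzero + g fzero +_) (prefixSum-tabulate-+ (f ∘ fsuc) (g ∘ fsuc) j))
        (solve 4 (λ a b c d → (a :+ b) :+ (c :+ d) := (a :+ c) :+ (b :+ d)) refl (f fzero) (g fzero) _ _)

prefixSum-tabulate-0 : ∀ m j → prefixSum j (tabulate {n = m} (λ _ → 0)) ≡ 0
prefixSum-tabulate-0 zero    zero    = refl
prefixSum-tabulate-0 zero    (suc j) = refl
prefixSum-tabulate-0 (suc m) zero    = refl
prefixSum-tabulate-0 (suc m) (suc j) = prefixSum-tabulate-0 m j

prefixSum+drop : ∀ {m} j (v : Vec ℕ m) → prefixSum j v + sum (drop j (toList v)) ≡ vecSum v
prefixSum+drop j v = trans (sym (sum-++ (take j (toList v)) _)) (cong sum (List.take++drop≡id j (toList v)))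

prefixSum-all : ∀ {m} (v : Vec ℕ m) → prefixSum m v ≡ vecSum v
prefixSum-all {m} v = cong sum (List.take-all m (toList v) (≤-reflexive (Vec.length-toList v)))

prefixSum≤vecSum : ∀ {m} j (v : Vec ℕ m) → prefixSum j v ≤ vecSum v
prefixSum≤vecSum j v = subst (prefixSum j v ≤_) (prefixSum+drop j v) (m≤m+n _ _)

tailΓ-all : ∀ {m k} (Γ : Vec (Vec ℕ m) k) → tailΓ m Γ ≡ 0
tailΓ-all []              = refl
tailΓ-all {m} (row ∷ Γ) =
  cong₂ _+_ (cong sum (List.drop-all m (toList row) (≤-reflexive (Vec.length-toList row)))) (tailΓ-all Γ)

prefixSum-colSum+tailΓ : ∀ {m k} j (Γ : Vec (Vec ℕ m) k) → prefixSum j (tabulate (colSum Γ)) + tailΓ j Γ ≡ sizeΓ Γ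
prefixSum-colSum+tailΓ {m} j []        = trans (+-identityʳ _) (prefixSum-tabulate-0 m j)
prefixSum-colSum+tailΓ j (row ∷ Γ) = begin
  prefixSum j (tabulate (λ r → lookup row r + colSum Γ r)) + (rowTail + tailΓ j Γ)
    ≡⟨ cong (_+ (rowTail + tailΓ j Γ)) (prefixSum-tabulate-+ (lookup row) (colSum Γ) j) ⟩
  (prefixSum j (tabulate (lookup row)) + prefixSum j (tabulate (colSum Γ))) + (rowTail + tailΓ j Γ)
    ≡⟨ cong (λ v → (prefixSum j v + prefixSum j (tabulate (colSum Γ))) + (rowTail + tailΓ j Γ)) (Vec.tabulate∘lookup row) ⟩
  (prefixSum j row + prefixSum j (tabulate (colSum Γ))) + (rowTail + tailΓ j Γ)
    ≡⟨ solve 4 (λ a b c d → (a :+ b) :+ (c :+ d) := (a :+ c) :+ (b :+ d)) refl (prefixSum j row) _ _ _ ⟩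
  (prefixSum j row + rowTail) + (prefixSum j (tabulate (colSum Γ)) + tailΓ j Γ)
    ≡⟨ cong₂ _+_ (prefixSum+drop j row) (prefixSum-colSum+tailΓ j Γ) ⟩
  vecSum row + sizeΓ Γ ∎
  where
  open ≡-Reasoning
  rowTail = sum (drop j (toList row))

vecSum-colSum : ∀ {m k} (Γ : Vec (Vec ℕ m) k) → vecSum (tabulate (colSum Γ)) ≡ sizeΓ Γ
vecSum-colSum {m} Γ = begin
  vecSum (tabulate (colSum Γ))                         ≡⟨ sym (prefixSum-all (tabulate (colSum Γ))) ⟩
  prefixSum m (tabulate (colSum Γ))                    ≡⟨ sym (+-identityʳ _) ⟩
  prefixSum m (tabulate (colSum Γ)) + 0                ≡⟨ cong (prefixSum m (tabulate (colSum Γ)) +_) (sym (tailΓ-all Γ)) ⟩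
  prefixSum m (tabulate (colSum Γ)) + tailΓ m Γ        ≡⟨ prefixSum-colSum+tailΓ m Γ ⟩
  sizeΓ Γ                                              ∎
  where open ≡-Reasoning

vecSum-tabulate-0 : ∀ m → vecSum (tabulate {n = m} (λ _ → 0)) ≡ 0
vecSum-tabulate-0 zero    = refl
vecSum-tabulate-0 (suc m) = vecSum-tabulate-0 m

vecSum-tabulate-+ : ∀ {m} (f g : Fin m → ℕ) → vecSum (tabulate (λ r → f r + g r)) ≡ vecSum (tabulate f) + vecSum (tabulate g)
vecSum-tabulate-+ {m} f g =
  trans (sym (prefixSum-all (tabulate (λ r → f r + g r))))
        (trans (prefixSum-tabulate-+ f g m) (cong₂ _+_ (prefixSum-all (tabulate f)) (prefixSum-all (tabulate g))))

vecSum-blockSize : ∀ {m i} (κ : Vec (Fin m) i) → vecSum (tabulate (blockSize κ)) ≡ i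
vecSum-blockSize {m} []  = vecSum-tabulate-0 m
vecSum-blockSize (a ∷ κ) = begin
  vecSum (tabulate (blockSize (a ∷ κ)))
    ≡⟨ cong vecSum (Vec.tabulate-cong (λ r → length-filter-∷ (_≟ᶠ r) a (toList κ))) ⟩
  vecSum (tabulate (λ r → indicator (a ≟ᶠ r) + blockSize κ r))
    ≡⟨ vecSum-tabulate-+ (λ r → indicator (a ≟ᶠ r)) (blockSize κ) ⟩
  vecSum (tabulate (λ r → indicator (a ≟ᶠ r))) + vecSum (tabulate (blockSize κ))
    ≡⟨ cong₂ _+_ (vecSum-indicator a) (vecSum-blockSize κ) ⟩
  suc _ ∎
  where
  open ≡-Reasoning
  vecSum-indicator : ∀ {m} (a : Fin m) → vecSum (tabulate (λ r → indicator (a ≟ᶠ r))) ≡ 1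
  vecSum-indicator {suc m} fzero    = cong suc (vecSum-tabulate-0 m)
  vecSum-indicator {suc m} (fsuc a) = vecSum-indicator a

vecSum-content : ∀ {m i k} (x : Config m i k) → vecSum (content x) ≡ i + sizeΓ (proj₂ x)
vecSum-content (κ , Γ) = trans (vecSum-tabulate-+ (blockSize κ) (colSum Γ)) (cong₂ _+_ (vecSum-blockSize κ) (vecSum-colSum Γ))

prev : ∀ {m} → Fin m → Fin m
prev {suc m} fzero    = fromℕ m
prev {suc m} (fsuc r) = inject₁ r

next : ∀ {m} → Fin m → Fin m
next r with view r
... | ‵fromℕ     = fzero
... | ‵inject₁ s = fsuc s

next-prev : ∀ {m} (r : Fin m) → next (prev r) ≡ r
next-prev {suc m} fzero    rewrite view-fromℕ m    = refl
next-prev {suc m} (fsuc r) rewrite view-inject₁ r = refl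

prev-next : ∀ {m} (r : Fin m) → prev (next r) ≡ r
prev-next r with view r
... | ‵fromℕ     = refl
... | ‵inject₁ s = refl

rotateᵛ : ∀ {m} → Vec A m → Vec A m
rotateᵛ []       = []
rotateᵛ (x ∷ xs) = xs ∷ʳ x

rotateᵛ⁻¹ : ∀ {m} → Vec A m → Vec A m
rotateᵛ⁻¹ {m = zero}  [] = []
rotateᵛ⁻¹ {m = suc m} v  = last v ∷ init v

rotateᵛ⁻¹-rotateᵛ : ∀ {m} (v : Vec A m) → rotateᵛ⁻¹ (rotateᵛ v) ≡ v
rotateᵛ⁻¹-rotateᵛ []       = refl
rotateᵛ⁻¹-rotateᵛ (x ∷ xs) = cong₂ _∷_ (Vec.last-∷ʳ x xs) (Vec.init-∷ʳ x xs)

rotateᵛ-rotateᵛ⁻¹ : ∀ {m} (v : Vec A m) → rotateᵛ (rotateᵛ⁻¹ v) ≡ v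
rotateᵛ-rotateᵛ⁻¹ {m = zero}  [] = refl
rotateᵛ-rotateᵛ⁻¹ {m = suc m} v with initLast v
... | _ , _ , refl = refl

lookup-∷ʳ-fromℕ : ∀ {n} (x : A) (ys : Vec A n) → lookup (ys ∷ʳ x) (fromℕ n) ≡ x
lookup-∷ʳ-fromℕ x []       = refl
lookup-∷ʳ-fromℕ x (y ∷ ys) = lookup-∷ʳ-fromℕ x ys

lookup-∷ʳ-inject₁ : ∀ {n} (x : A) (ys : Vec A n) (s : Fin n) → lookup (ys ∷ʳ x) (inject₁ s) ≡ lookup ys s
lookup-∷ʳ-inject₁ x (y ∷ ys) fzero    = refl
lookup-∷ʳ-inject₁ x (y ∷ ys) (fsuc s) = lookup-∷ʳ-inject₁ x ys s

lookup-rotateᵛ : ∀ {m} (v : Vec A m) (r : Fin m) → lookup (rotateᵛ v) r ≡ lookup v (next r)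
lookup-rotateᵛ (x ∷ xs) r with view r
... | ‵fromℕ     = lookup-∷ʳ-fromℕ x xs
... | ‵inject₁ s = lookup-∷ʳ-inject₁ x xs s

vecSum-rotateᵛ : ∀ {m} (v : Vec ℕ m) → vecSum (rotateᵛ v) ≡ vecSum v
vecSum-rotateᵛ []       = refl
vecSum-rotateᵛ (x ∷ xs) = begin
  sum (toList (xs ∷ʳ x))      ≡⟨ cong sum (Vec.toList-∷ʳ x xs) ⟩
  sum (toList xs ++ x ∷ [])   ≡⟨ sum-++ (toList xs) (x ∷ []) ⟩
  vecSum xs + (x + 0)         ≡⟨ solve 2 (λ s x → s :+ (x :+ con 0) := x :+ s) refl (vecSum xs) x ⟩
  x + vecSum xs               ∎
  where open ≡-Reasoning

vecSum-rotateᵛ⁻¹ : ∀ {m} (v : Vec ℕ m) → vecSum (rotateᵛ⁻¹ v) ≡ vecSum v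
vecSum-rotateᵛ⁻¹ v = trans (sym (vecSum-rotateᵛ (rotateᵛ⁻¹ v))) (cong vecSum (rotateᵛ-rotateᵛ⁻¹ v))

toList-rotateᵛ : ∀ {m} (v : Vec A m) → toList (rotateᵛ v) ≡ rotate 1 (toList v)
toList-rotateᵛ []       = refl
toList-rotateᵛ (x ∷ xs) = Vec.toList-∷ʳ x xs

rotateConfig : ∀ {m i k} → Config m i k → Config m i k
rotateConfig (κ , Γ) = Vec.map prev κ , Vec.map rotateᵛ Γ

rotateConfig⁻¹ : ∀ {m i k} → Config m i k → Config m i k
rotateConfig⁻¹ (κ , Γ) = Vec.map next κ , Vec.map rotateᵛ⁻¹ Γ

rotateConfig⁻¹-rotateConfig : ∀ {m i k} (x : Config m i k) → rotateConfig⁻¹ (rotateConfig x) ≡ x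
rotateConfig⁻¹-rotateConfig (κ , Γ) =
  cong₂ _,_ (map-inverse next prev next-prev κ) (map-inverse rotateᵛ⁻¹ rotateᵛ rotateᵛ⁻¹-rotateᵛ Γ)

rotateConfig-rotateConfig⁻¹ : ∀ {m i k} (x : Config m i k) → rotateConfig (rotateConfig⁻¹ x) ≡ x
rotateConfig-rotateConfig⁻¹ (κ , Γ) =
  cong₂ _,_ (map-inverse prev next prev-next κ) (map-inverse rotateᵛ rotateᵛ⁻¹ rotateᵛ-rotateᵛ⁻¹ Γ)

sizeΓ-map : ∀ {m k} (f : Vec ℕ m → Vec ℕ m) → (∀ v → vecSum (f v) ≡ vecSum v) →
  (Γ : Vec (Vec ℕ m) k) → sizeΓ (Vec.map f Γ) ≡ sizeΓ Γ
sizeΓ-map f f-sum []      = refl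
sizeΓ-map f f-sum (r ∷ Γ) = cong₂ _+_ (f-sum r) (sizeΓ-map f f-sum Γ)

sizeΓ-rotateConfig : ∀ {m i k} (x : Config m i k) → sizeΓ (proj₂ (rotateConfig x)) ≡ sizeΓ (proj₂ x)
sizeΓ-rotateConfig (κ , Γ) = sizeΓ-map rotateᵛ vecSum-rotateᵛ Γ

sizeΓ-rotateConfig⁻¹ : ∀ {m i k} (x : Config m i k) → sizeΓ (proj₂ (rotateConfig⁻¹ x)) ≡ sizeΓ (proj₂ x)
sizeΓ-rotateConfig⁻¹ (κ , Γ) = sizeΓ-map rotateᵛ⁻¹ vecSum-rotateᵛ⁻¹ Γ

blockSize-map-prev : ∀ {m i} (κ : Vec (Fin m) i) (r : Fin m) → blockSize (Vec.map prev κ) r ≡ blockSize κ (next r)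
blockSize-map-prev κ r = begin
  length (filter (_≟ᶠ r) (toList (Vec.map prev κ))) ≡⟨ cong (length ∘ filter (_≟ᶠ r)) (Vec.toList-map prev κ) ⟩
  length (filter (_≟ᶠ r) (map prev (toList κ)))     ≡⟨ length-filter-map prev (_≟ᶠ r) (toList κ) ⟩
  length (filter (λ a → prev a ≟ᶠ r) (toList κ))     ≡⟨ length-filter-cong _ (_≟ᶠ next r) (toList κ) (λ _ → prev≡⇔≡next) ⟩
  length (filter (_≟ᶠ next r) (toList κ))            ∎
  where
  open ≡-Reasoning
  prev≡⇔≡next : ∀ {a} → prev a ≡ r ⇔ a ≡ next r
  prev≡⇔≡next {a} = mk⇔ (λ eq → trans (sym (next-prev a)) (cong next eq)) (λ eq → trans (cong prev eq) (prev-next r))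

colSum-map-rotateᵛ : ∀ {m k} (Γ : Vec (Vec ℕ m) k) (r : Fin m) → colSum (Vec.map rotateᵛ Γ) r ≡ colSum Γ (next r)
colSum-map-rotateᵛ []        r = refl
colSum-map-rotateᵛ (row ∷ Γ) r = cong₂ _+_ (lookup-rotateᵛ row r) (colSum-map-rotateᵛ Γ r)

content-rotateConfig : ∀ {m i k} (x : Config m i k) → content (rotateConfig x) ≡ rotateᵛ (content x)
content-rotateConfig (κ , Γ) = begin
  tabulate (λ r → blockSize (Vec.map prev κ) r + colSum (Vec.map rotateᵛ Γ) r)
    ≡⟨ Vec.tabulate-cong (λ r → cong₂ _+_ (blockSize-map-prev κ r) (colSum-map-rotateᵛ Γ r)) ⟩
  tabulate (λ r → blockSize κ (next r) + colSum Γ (next r))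
    ≡⟨ Vec.tabulate-cong (λ r → sym (trans (lookup-rotateᵛ (content (κ , Γ)) r) (Vec.lookup∘tabulate _ (next r)))) ⟩
  tabulate (lookup (rotateᵛ (content (κ , Γ))))
    ≡⟨ Vec.tabulate∘lookup (rotateᵛ (content (κ , Γ))) ⟩
  rotateᵛ (content (κ , Γ)) ∎
  where open ≡-Reasoning

content-iter-rotateConfig : ∀ {m i k} d (x : Config m i k) → d ≤ m →
  toList (content (iter rotateConfig d x)) ≡ rotate d (toList (content x))
content-iter-rotateConfig zero    x _   = sym (List.++-identityʳ (toList (content x)))
content-iter-rotateConfig (suc d) x d<m = begin
  toList (content (rotateConfig (iter rotateConfig d x))) ≡⟨ cong toList (content-rotateConfig (iter rotateConfig d x)) ⟩
  toList (rotateᵛ (content (iter rotateConfig d x)))      ≡⟨ toList-rotateᵛ (content (iter rotateConfig d x)) ⟩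
  rotate 1 (toList (content (iter rotateConfig d x)))     ≡⟨ cong (rotate 1) (content-iter-rotateConfig d x (<⇒≤ d<m)) ⟩
  rotate 1 (rotate d (toList (content x)))               ≡⟨ rotate-suc d _ (subst (d <_) (sym (Vec.length-toList (content x))) d<m) ⟩
  rotate (suc d) (toList (content x))                    ∎
  where open ≡-Reasoning

DominatingConfig : ∀ {m i k} → Config m i k → Set
DominatingConfig x = Dominating (toList (content x))

dominatingConfig? : ∀ {m i k} (x : Config m i k) → Dec (DominatingConfig x)
dominatingConfig? x = dominating? (toList (content x))

module RotationCounting (L i k g : ℕ) (i+g≡L : i + g ≡ L) where

  X : List (Config (suc L) i k)
  X = configs (suc L) i k g

  ∈X-iter : (f : Config (suc L) i k → Config (suc L) i k) → (∀ x → sizeΓ (proj₂ (f x)) ≡ sizeΓ (proj₂ x)) →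
    ∀ d {x} → x ∈ X → iter f d x ∈ X
  ∈X-iter f f-size d {x} x∈ = subst (λ g → iter f d x ∈ configs (suc L) i k g)
    (trans (iter-invariant f (sizeΓ ∘ proj₂) f-size d x) (∈-configs⁻ x∈)) (∈-configs⁺ (iter f d x))

  dominant : List (Config (suc L) i k)
  dominant = filter dominatingConfig? X

  DominatingAfter : ℕ → Config (suc L) i k → Set
  DominatingAfter d x = DominatingConfig (iter rotateConfig d x)

  dominatingAfter? : ∀ d x → Dec (DominatingAfter d x)
  dominatingAfter? d x = dominatingConfig? (iter rotateConfig d x)

  length-dominatingAfter : ∀ d → length (filter (dominatingAfter? d) X) ≡ length dominant
  length-dominatingAfter d = trans (sym (List.length-map (iter rotateConfig d) (filter (dominatingAfter? d) X)))
    (unique∧set⇒length≡ (map⁺ (iter-injective rotateConfig rotateConfig⁻¹ rotateConfig⁻¹-rotateConfig d)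
                              (filter⁺ (dominatingAfter? d) (configs⁺ (suc L) i k g)))
                        (filter⁺ dominatingConfig? (configs⁺ (suc L) i k g))
                        (mk⇔ into onto))
    where
    into : ∀ {z} → z ∈ map (iter rotateConfig d) (filter (dominatingAfter? d) X) → z ∈ dominant
    into z∈ with ∈-map⁻ (iter rotateConfig d) z∈
    ... | x , x∈ , refl with ∈-filter⁻ (dominatingAfter? d) x∈
    ...   | x∈X , dominating = ∈-filter⁺ dominatingConfig? (∈X-iter rotateConfig sizeΓ-rotateConfig d x∈X) dominating
    onto : ∀ {z} → z ∈ dominant → z ∈ map (iter rotateConfig d) (filter (dominatingAfter? d) X)
    onto {z} z∈ with ∈-filter⁻ dominatingConfig? z∈
    ... | z∈X , dominating = subst (λ y → y ∈ map (iter rotateConfig d) (filter (dominatingAfter? d) X)) z≡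
          (∈-map⁺ (iter rotateConfig d) (∈-filter⁺ (dominatingAfter? d)
            (∈X-iter rotateConfig⁻¹ sizeΓ-rotateConfig⁻¹ d z∈X) (subst DominatingConfig (sym z≡) dominating)))
      where
      x = iter rotateConfig⁻¹ d z
      z≡ : iter rotateConfig d x ≡ z
      z≡ = iter-inverseˡ rotateConfig rotateConfig⁻¹ rotateConfig-rotateConfig⁻¹ d z

  exactly-one-dominating-rotation : ∀ {x} → x ∈ X → length (filter (λ d → dominatingAfter? d x) (upTo (suc L))) ≡ 1
  exactly-one-dominating-rotation {x} x∈ =
    trans (length-filter-cong (λ d → dominatingAfter? d x) (λ d → dominating? (rotate d ℓ)) (upTo (suc L)) same)
          (CycleLemma.exactly-one-dominating-rotation ℓ (Vec.length-toList (content x)) sum≡)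
    where
    ℓ = toList (content x)
    sum≡ : sum ℓ ≡ L
    sum≡ = trans (vecSum-content x) (trans (cong (i +_) (∈-configs⁻ x∈)) i+g≡L)
    same : ∀ {d} → d ∈ upTo (suc L) → DominatingAfter d x ⇔ Dominating (rotate d ℓ)
    same d∈ = mk⇔ (subst Dominating rotated) (subst Dominating (sym rotated))
      where rotated = content-iter-rotateConfig _ x (<⇒≤ (∈-upTo⁻ d∈))

  rotation-count : suc L * length dominant ≡ length X
  rotation-count = begin
    suc L * length dominant
      ≡⟨ cong (_* length dominant) (sym (List.length-upTo (suc L))) ⟩
    length (upTo (suc L)) * length dominant
      ≡⟨ sym (sum-map-const (length dominant) (upTo (suc L))) ⟩
    sum (map (λ _ → length dominant) (upTo (suc L)))
      ≡⟨ sum-map-cong (upTo (suc L)) (λ {d} _ → sym (length-dominatingAfter d)) ⟩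
    sum (map (λ d → length (filter (dominatingAfter? d) X)) (upTo (suc L)))
      ≡⟨ double-counting dominatingAfter? (upTo (suc L)) X ⟩
    sum (map (λ x → length (filter (λ d → dominatingAfter? d x) (upTo (suc L)))) X)
      ≡⟨ sum-map-cong X exactly-one-dominating-rotation ⟩
    sum (map (λ _ → 1) X)
      ≡⟨ sum-map-const 1 X ⟩
    length X * 1
      ≡⟨ *-identityʳ (length X) ⟩
    length X ∎
    where open ≡-Reasoning

appendZeroColumn : ∀ {m k} → Vec (Vec ℕ m) k → Vec (Vec ℕ (suc m)) k
appendZeroColumn = Vec.map (_∷ʳ 0)

dropLastColumn : ∀ {m k} → Vec (Vec ℕ (suc m)) k → Vec (Vec ℕ m) k
dropLastColumn = Vec.map init

dropLastColumn-appendZeroColumn : ∀ {m k} (Γ : Vec (Vec ℕ m) k) → dropLastColumn (appendZeroColumn Γ) ≡ Γ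
dropLastColumn-appendZeroColumn = map-inverse init (_∷ʳ 0) (Vec.init-∷ʳ 0)

tailΓ-appendZeroColumn : ∀ {m k} j (Γ : Vec (Vec ℕ m) k) → tailΓ j (appendZeroColumn Γ) ≡ tailΓ j Γ
tailΓ-appendZeroColumn j []        = refl
tailΓ-appendZeroColumn j (row ∷ Γ) = cong₂ _+_ (trans (cong (sum ∘ drop j) (Vec.toList-∷ʳ 0 row)) (sum-drop-++-0 (toList row) j))
                                                 (tailΓ-appendZeroColumn j Γ)
  where
  sum-drop-++-0 : (xs : List ℕ) (j : ℕ) → sum (drop j (xs ++ 0 ∷ [])) ≡ sum (drop j xs)
  sum-drop-++-0 []       zero    = refl
  sum-drop-++-0 []       (suc j) = cong sum (List.drop-[] j)
  sum-drop-++-0 (x ∷ xs) zero    = trans (sum-++ (x ∷ xs) (0 ∷ [])) (+-identityʳ _)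
  sum-drop-++-0 (x ∷ xs) (suc j) = sum-drop-++-0 xs j

appendZeroColumn-dropLastColumn : ∀ {m k} (Γ : Vec (Vec ℕ (suc m)) k) → tailΓ m Γ ≡ 0 → appendZeroColumn (dropLastColumn Γ) ≡ Γ
appendZeroColumn-dropLastColumn []        _        = refl
appendZeroColumn-dropLastColumn {m} (row ∷ Γ) tail≡0 =
  cong₂ _∷_ (last-zero row (m+n≡0⇒m≡0 _ tail≡0)) (appendZeroColumn-dropLastColumn Γ (m+n≡0⇒n≡0 _ tail≡0))
  where
  last-zero : (row : Vec ℕ (suc m)) → sum (drop m (toList row)) ≡ 0 → init row ∷ʳ 0 ≡ row
  last-zero row sum≡0 with initLast row
  ... | ys , y , refl = cong (ys ∷ʳ_) (sym (begin
    y                                  ≡⟨ sym (+-identityʳ y) ⟩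
    sum (y ∷ [])                       ≡⟨ cong sum (sym (drop-++ʳ (toList ys) (y ∷ []))) ⟩
    sum (drop (length (toList ys)) (toList ys ++ y ∷ [])) ≡⟨ cong (λ e → sum (drop e (toList ys ++ y ∷ []))) (Vec.length-toList ys) ⟩
    sum (drop m (toList ys ++ y ∷ []))  ≡⟨ cong (sum ∘ drop m) (sym (Vec.toList-∷ʳ y ys)) ⟩
    sum (drop m (toList (ys ∷ʳ y)))     ≡⟨ sum≡0 ⟩
    0                                  ∎))
    where open ≡-Reasoning

DiagramData : (m i k : ℕ) → Set
DiagramData m i k = Vec ℕ m × Vec (Fin m) i × Vec (Vec ℕ (m ∸ 1)) k

-- IsDiagram k n i, with m = n − k and the bounds τ j′ = T_{k+j′}, μ = M − i, ν = n − 2 left abstract.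
IsDiagramWith : (m i k : ℕ) (τ : ℕ → ℕ) (μ ν : ℕ) → DiagramData m i k → Set
IsDiagramWith m i k τ μ ν (q , κ , Γ) =
    sum (toList q) ≡ i
  × (∀ j′ → j′ ≤ m → τ j′ ≤ μ + prefixSum j′ q)
  × (∀ (r : Fin m) → blockSize κ r ≡ lookup q r)
  × sizeΓ Γ ≡ m ∸ 1 ∸ i
  × (∀ j′ → 1 ≤ j′ → k + j′ ≤ ν → tailΓ j′ Γ ≤ (μ + prefixSum j′ q) ∸ τ j′)

module Diagrams (L i k g a : ℕ) (τ : ℕ → ℕ) (μ ν : ℕ) (i+g≡L : i + g ≡ L)
                (τ-inner : ∀ j → j ≤ L → τ j ≡ a + j) (τ-last : τ (suc L) ≡ a + L) (μ≡ : μ ≡ a + g)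
                (ν-range : ∀ j → k + j ≤ ν ⇔ suc j < suc L) where

  open RotationCounting L i k g i+g≡L

  Q : Vec (Fin (suc L)) i → ℕ → ℕ
  Q κ j = prefixSum j (tabulate (blockSize κ))

  Balanced : ∀ {p} → Vec (Fin (suc L)) i → Vec (Vec ℕ p) k → Set
  Balanced κ Γ = ∀ j → 1 ≤ j → j ≤ L → j + tailΓ j Γ ≤ Q κ j + g

  prefixSum-content+tailΓ : ∀ j κ (Γ : Vec (Vec ℕ (suc L)) k) → sizeΓ Γ ≡ g →
    prefixSum j (content (κ , Γ)) + tailΓ j Γ ≡ Q κ j + g
  prefixSum-content+tailΓ j κ Γ size≡ = begin
    prefixSum j (content (κ , Γ)) + tailΓ j Γ
      ≡⟨ cong (_+ tailΓ j Γ) (prefixSum-tabulate-+ (blockSize κ) (colSum Γ) j) ⟩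
    (Q κ j + prefixSum j (tabulate (colSum Γ))) + tailΓ j Γ
      ≡⟨ +-assoc (Q κ j) _ _ ⟩
    Q κ j + (prefixSum j (tabulate (colSum Γ)) + tailΓ j Γ)
      ≡⟨ cong (Q κ j +_) (trans (prefixSum-colSum+tailΓ j Γ) size≡) ⟩
    Q κ j + g ∎
    where open ≡-Reasoning

  dominating⇔balanced : ∀ κ (Γ : Vec (Vec ℕ (suc L)) k) → sizeΓ Γ ≡ g → DominatingConfig (κ , Γ) ⇔ Balanced κ Γ
  dominating⇔balanced κ Γ size≡ = mk⇔
    (λ dominating j 1≤j j≤L → subst (j + tailΓ j Γ ≤_) (prefixSum-content+tailΓ j κ Γ size≡)
       (+-monoˡ-≤ (tailΓ j Γ) (dominating (subst (j <_) (sym length≡) (s≤s j≤L)) 1≤j)))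
    (λ balanced {j} j<m 1≤j → +-cancelʳ-≤ (tailΓ j Γ) j (prefixSum j (content (κ , Γ)))
       (subst (j + tailΓ j Γ ≤_) (sym (prefixSum-content+tailΓ j κ Γ size≡))
              (balanced j 1≤j (≤-pred (subst (j <_) length≡ j<m)))))
    where
    length≡ : length (toList (content (κ , Γ))) ≡ suc L
    length≡ = Vec.length-toList (content (κ , Γ))

  Q≤i : ∀ κ j → Q κ j ≤ i
  Q≤i κ j = subst (Q κ j ≤_) (vecSum-blockSize κ) (prefixSum≤vecSum j (tabulate (blockSize κ)))

  balanced⇒last-column-zero : ∀ κ (Γ : Vec (Vec ℕ (suc L)) k) → sizeΓ Γ ≡ g → Balanced κ Γ → tailΓ L Γ ≡ 0
  balanced⇒last-column-zero κ Γ size≡ balanced with 1 ≤? L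
  ... | no  L≱1 = subst (λ L′ → tailΓ L′ Γ ≡ 0) (sym L≡0) (trans size≡ (m+n≡0⇒n≡0 i (trans i+g≡L L≡0)))
    where
    L≡0 : L ≡ 0
    L≡0 = n≤0⇒n≡0 (≮⇒≥ L≱1)
  ... | yes 1≤L = n≤0⇒n≡0 (+-cancelˡ-≤ L _ 0 (begin
    L + tailΓ L Γ ≤⟨ balanced L 1≤L ≤-refl ⟩
    Q κ L + g     ≤⟨ +-monoˡ-≤ g (Q≤i κ L) ⟩
    i + g         ≡⟨ i+g≡L ⟩
    L             ≡⟨ sym (+-identityʳ L) ⟩
    L + 0         ∎))
    where open ≤-Reasoning

  IsDiagram′ : DiagramData (suc L) i k → Set
  IsDiagram′ = IsDiagramWith (suc L) i k τ μ ν

  shift⇔ : ∀ j t q → j + t ≤ q + g ⇔ t + (a + j) ≤ (a + g) + q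
  shift⇔ j t q = ≤-⇔-shift a 0
    (solve 3 (λ a j t → a :+ (j :+ t) := (t :+ (a :+ j)) :+ con 0) refl a j t)
    (solve 3 (λ a q g → a :+ (q :+ g) := ((a :+ g) :+ q) :+ con 0) refl a q g)

  Q-all : ∀ κ → Q κ (suc L) ≡ i
  Q-all κ = trans (prefixSum-all (tabulate (blockSize κ))) (vecSum-blockSize κ)

  balanced-appendZeroColumn : ∀ κ (Γ : Vec (Vec ℕ L) k) → Balanced κ (appendZeroColumn Γ) ⇔ Balanced κ Γ
  balanced-appendZeroColumn κ Γ = mk⇔
    (λ balanced j 1≤j j≤L → subst (λ t → j + t ≤ Q κ j + g) (tailΓ-appendZeroColumn j Γ) (balanced j 1≤j j≤L))
    (λ balanced j 1≤j j≤L → subst (λ t → j + t ≤ Q κ j + g) (sym (tailΓ-appendZeroColumn j Γ)) (balanced j 1≤j j≤L))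

  balanced⇒diagram : ∀ κ (Γ : Vec (Vec ℕ L) k) → sizeΓ Γ ≡ g → Balanced κ Γ → IsDiagram′ (tabulate (blockSize κ) , κ , Γ)
  balanced⇒diagram κ Γ size≡ balanced =
    vecSum-blockSize κ , lower-bounds , (λ r → sym (Vec.lookup∘tabulate (blockSize κ) r)) , trans size≡ g≡L∸i , tail-bounds
    where
    g≡L∸i : g ≡ L ∸ i
    g≡L∸i = sym (trans (cong (_∸ i) (sym i+g≡L)) (m+n∸m≡n i g))
    bound : ∀ j′ {e} → τ j′ ≡ a + e → e ≤ Q κ j′ + g → τ j′ ≤ μ + Q κ j′
    bound j′ {e} τ≡ e≤ = subst₂ _≤_ (sym τ≡) (cong (_+ Q κ j′) (sym μ≡))
      (Equivalence.to (shift⇔ e 0 (Q κ j′)) (subst (_≤ Q κ j′ + g) (sym (+-identityʳ e)) e≤))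
    lower-bounds : ∀ j′ → j′ ≤ suc L → τ j′ ≤ μ + Q κ j′
    lower-bounds j′ j′≤L+1 with m≤n⇒m<n∨m≡n j′≤L+1
    ... | inj₂ refl = bound (suc L) τ-last (subst (L ≤_) (sym (cong (_+ g) (Q-all κ))) (≤-reflexive (sym i+g≡L)))
    ... | inj₁ (s≤s j′≤L) with j′
    ...   | zero   = bound 0 (τ-inner 0 z≤n) z≤n
    ...   | suc j  = bound (suc j) (τ-inner (suc j) j′≤L)
                       (≤-trans (m≤m+n (suc j) _) (balanced (suc j) (s≤s z≤n) j′≤L))
    tail-bounds : ∀ j′ → 1 ≤ j′ → k + j′ ≤ ν → tailΓ j′ Γ ≤ (μ + Q κ j′) ∸ τ j′
    tail-bounds j′ 1≤j′ k+j′≤ν = subst₂ (λ m t → tailΓ j′ Γ ≤ (m + Q κ j′) ∸ t) (sym μ≡) (sym (τ-inner j′ j′≤L))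
      (m+n≤o⇒m≤o∸n (tailΓ j′ Γ) (Equivalence.to (shift⇔ j′ (tailΓ j′ Γ) (Q κ j′)) (balanced j′ 1≤j′ j′≤L)))
      where
      j′≤L : j′ ≤ L
      j′≤L = <⇒≤ (≤-pred (Equivalence.to (ν-range j′) k+j′≤ν))

  diagram-blockSizes : ∀ {q κ Γ} → IsDiagram′ (q , κ , Γ) → q ≡ tabulate (blockSize κ)
  diagram-blockSizes {q} (_ , _ , q≡blockSize , _) =
    trans (sym (Vec.tabulate∘lookup q)) (Vec.tabulate-cong (λ r → sym (q≡blockSize r)))

  diagram⇒balanced : ∀ {q κ Γ} → IsDiagram′ (q , κ , Γ) → Balanced κ Γ
  diagram⇒balanced {q} {κ} {Γ} diagram@(_ , lower-bounds , _ , _ , tail-bounds) j 1≤j j≤L =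
    Equivalence.from (shift⇔ j (tailΓ j Γ) (Q κ j))
                     (subst₂ (λ t m → tailΓ j Γ + t ≤ m + Q κ j) (τ-inner j j≤L) μ≡ (with-tail j≤L))
    where
    prefix≡ : prefixSum j q ≡ Q κ j
    prefix≡ = cong (prefixSum j) (diagram-blockSizes {q} {κ} {Γ} diagram)
    lower : τ j ≤ μ + Q κ j
    lower = subst (λ p → τ j ≤ μ + p) prefix≡ (lower-bounds j (m≤n⇒m≤1+n j≤L))
    with-tail : j ≤ L → tailΓ j Γ + τ j ≤ μ + Q κ j
    with-tail j≤L with j <? L
    ... | yes j<L = m≤o∸n⇒m+n≤o (tailΓ j Γ) lower
                      (subst (λ p → tailΓ j Γ ≤ (μ + p) ∸ τ j) prefix≡
                             (tail-bounds j 1≤j (Equivalence.from (ν-range j) (s≤s j<L))))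
    ... | no  j≮L = subst (λ t → t + τ j ≤ μ + Q κ j) (sym tail≡0) lower
      where
      tail≡0 : tailΓ j Γ ≡ 0
      tail≡0 = subst (λ j → tailΓ j Γ ≡ 0) (sym (≤-antisym j≤L (≮⇒≥ j≮L))) (tailΓ-all Γ)

  toDiagram : Config (suc L) i k → DiagramData (suc L) i k
  toDiagram (κ , Γ) = tabulate (blockSize κ) , κ , dropLastColumn Γ

  fromDiagram : DiagramData (suc L) i k → Config (suc L) i k
  fromDiagram (_ , κ , Γ) = κ , appendZeroColumn Γ

  diagrams : List (DiagramData (suc L) i k)
  diagrams = map toDiagram dominant

  dominant⇒balanced : ∀ {κ Γ} → (κ , Γ) ∈ dominant →
    sizeΓ Γ ≡ g × Balanced κ Γ × appendZeroColumn (dropLastColumn Γ) ≡ Γ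
  dominant⇒balanced {κ} {Γ} x∈ with ∈-filter⁻ dominatingConfig? x∈
  ... | x∈X , dominating = size≡ , balanced , appendZeroColumn-dropLastColumn Γ (balanced⇒last-column-zero κ Γ size≡ balanced)
    where
    size≡ = ∈-configs⁻ x∈X
    balanced = Equivalence.to (dominating⇔balanced κ Γ size≡) dominating

  ∈-diagrams⁻ : ∀ {y} → y ∈ diagrams → IsDiagram′ y
  ∈-diagrams⁻ y∈ with ∈-map⁻ toDiagram y∈
  ... | (κ , Γ) , x∈ , refl with dominant⇒balanced x∈
  ...   | size≡ , balanced , Γ≡ = balanced⇒diagram κ (dropLastColumn Γ)
          (trans (sym (tailΓ-appendZeroColumn 0 (dropLastColumn Γ))) (trans (cong sizeΓ Γ≡) size≡))
          (Equivalence.to (balanced-appendZeroColumn κ (dropLastColumn Γ)) (subst (Balanced κ) (sym Γ≡) balanced))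

  ∈-diagrams⁺ : ∀ y → IsDiagram′ y → y ∈ diagrams
  ∈-diagrams⁺ y@(q , κ , Γ) diagram@(_ , _ , _ , size≡ , _) =
    subst (_∈ diagrams) toDiagram-fromDiagram (∈-map⁺ toDiagram (∈-filter⁺ dominatingConfig? x∈X dominating))
    where
    size≡g : sizeΓ (appendZeroColumn Γ) ≡ g
    size≡g = trans (tailΓ-appendZeroColumn 0 Γ) (trans size≡ (trans (cong (_∸ i) (sym i+g≡L)) (m+n∸m≡n i g)))
    x∈X : fromDiagram y ∈ X
    x∈X = subst (λ g → fromDiagram y ∈ configs (suc L) i k g) size≡g (∈-configs⁺ (fromDiagram y))
    dominating : DominatingConfig (fromDiagram y)
    dominating = Equivalence.from (dominating⇔balanced κ (appendZeroColumn Γ) size≡g)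
      (Equivalence.from (balanced-appendZeroColumn κ Γ) (diagram⇒balanced {q} {κ} {Γ} diagram))
    toDiagram-fromDiagram : toDiagram (fromDiagram y) ≡ y
    toDiagram-fromDiagram = cong₂ _,_ (sym (diagram-blockSizes {q} {κ} {Γ} diagram)) (cong (κ ,_) (dropLastColumn-appendZeroColumn Γ))

  diagrams⁺ : Unique diagrams
  diagrams⁺ = map⁻ (subst Unique (sym fromDiagram∘toDiagram) (filter⁺ dominatingConfig? (configs⁺ (suc L) i k g)))
    where
    fromDiagram∘toDiagram : map fromDiagram diagrams ≡ dominant
    fromDiagram∘toDiagram = trans (sym (List.map-∘ dominant))
      (trans (List.map-cong-local (All.tabulate (λ {x} x∈ → cong (proj₁ x ,_) (proj₂ (proj₂ (dominant⇒balanced x∈))))))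
             (List.map-id dominant))

  length-diagrams : suc L * length diagrams ≡ length X
  length-diagrams = trans (cong (suc L *_) (List.length-map toDiagram dominant)) rotation-count

diagram-enumeration : ∀ {m k′ L i g a top} {τ : ℕ → ℕ} {μ ν} → m ≡ suc L → i + g ≡ L →
  (∀ j → j ≤ L → τ j ≡ a + j) → τ (suc L) ≡ a + L → μ ≡ a + g → (∀ j → suc k′ + j ≤ ν ⇔ suc j < suc L) →
  L + k′ * m + g ≡ top →
  Σ ℕ λ N → Σ (Fin N → DiagramData m i (suc k′)) λ f → Injective _≡_ _≡_ f
    × (∀ y → IsDiagramWith m i (suc k′) τ μ ν y ⇔ ∃ λ b → f b ≡ y)
    × m * N ≡ m ^ i * (top C g)
diagram-enumeration {k′ = k′} {L} {i} {g} {a} {τ = τ} {μ} {ν} refl i+g≡L τ-inner τ-last μ≡ ν-range refl =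
  let f , f-injective , f-onto = enumeration-resp-⇔ (λ y → mk⇔ (∈-diagrams⁺ y) ∈-diagrams⁻) (lookup-enumeration diagrams⁺)
  in  length diagrams , f , f-injective , f-onto , trans length-diagrams (length-configs L i k′ g)
  where open Diagrams L i (suc k′) g a τ μ ν i+g≡L τ-inner τ-last μ≡ ν-range

<ᵇ-true : ∀ {m n} → m < n → (m <ᵇ n) ≡ true
<ᵇ-true = Equivalence.to T-≡ ∘ <⇒<ᵇ

<ᵇ-false : ∀ {m n} → n ≤ m → (m <ᵇ n) ≡ false
<ᵇ-false {m} {n} n≤m = ¬-not (λ eq → <⇒≱ (<ᵇ⇒< m n (Equivalence.from T-≡ eq)) n≤m)

≡ᵇ-refl : ∀ m → (m ≡ᵇ m) ≡ true
≡ᵇ-refl m = Equivalence.to T-≡ (≡⇒≡ᵇ m m refl)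

≡ᵇ-false : ∀ {m n} → m ≢ n → (m ≡ᵇ n) ≡ false
≡ᵇ-false {m} {n} m≢n = ¬-not (m≢n ∘ ≡ᵇ⇒≡ m n ∘ Equivalence.from T-≡)

t-below : ∀ {k n j} → j < k → t k n j ≡ n ∸ k
t-below j<k rewrite <ᵇ-true j<k = refl

t-at : ∀ k n → t k n k ≡ n ∸ k ∸ 1
t-at k n rewrite <ᵇ-false {k} {k} ≤-refl | ≡ᵇ-refl k = refl

t-between : ∀ {k n j} → k < j → j < n → t k n j ≡ 1
t-between {k} {n} {j} k<j j<n rewrite <ᵇ-false (<⇒≤ k<j) | ≡ᵇ-false {j} {k} (>⇒≢ k<j) | <ᵇ-true j<n = refl

t-top : ∀ {k n} → k < n → t k n n ≡ 0
t-top {k} {n} k<n rewrite <ᵇ-false (<⇒≤ k<n) | ≡ᵇ-false {n} {k} (>⇒≢ k<n) | <ᵇ-false {n} {n} ≤-refl = refl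

module CarThresholds (k′ L : ℕ) where
  private
    k = suc k′
    n = suc k + L
    a = k′ * suc L + L

  n∸k≡ : n ∸ k ≡ suc L
  n∸k≡ = trans (cong (_∸ k) (sym (+-suc k L))) (m+n∸m≡n k (suc L))

  T-below : ∀ j → j ≤ k′ → T k n j ≡ j * suc L
  T-below zero    _      = refl
  T-below (suc j) j<k′ = begin
    T k n j + t k n (suc j) ≡⟨ cong₂ _+_ (T-below j (<⇒≤ j<k′)) (trans (t-below {k} {n} (s≤s j<k′)) n∸k≡) ⟩
    j * suc L + suc L       ≡⟨ +-comm (j * suc L) (suc L) ⟩
    suc j * suc L           ∎
    where open ≡-Reasoning

  T-at : T k n k ≡ a
  T-at = cong₂ _+_ (T-below k′ ≤-refl) (trans (t-at k n) (cong (_∸ 1) n∸k≡))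

  T-inner : ∀ j → j ≤ L → T k n (k + j) ≡ a + j
  T-inner zero    _     = trans (cong (T k n) (+-identityʳ k)) (trans T-at (sym (+-identityʳ a)))
  T-inner (suc j) j<L = begin
    T k n (k + suc j)                   ≡⟨ cong (T k n) (+-suc k j) ⟩
    T k n (k + j) + t k n (suc (k + j))
      ≡⟨ cong₂ _+_ (T-inner j (<⇒≤ j<L)) (t-between {k} {n} (s≤s (m≤m+n k j)) (s≤s (+-monoʳ-< k j<L))) ⟩
    a + j + 1                           ≡⟨ trans (+-assoc a j 1) (cong (a +_) (+-comm j 1)) ⟩
    a + suc j                           ∎
    where open ≡-Reasoning

  T-last : T k n (k + suc L) ≡ a + L
  T-last = begin
    T k n (k + suc L)                   ≡⟨ cong (T k n) (+-suc k L) ⟩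
    T k n (k + L) + t k n (suc (k + L)) ≡⟨ cong₂ _+_ (T-inner L ≤-refl) (t-top {k} {n} (s≤s (m≤m+n k L))) ⟩
    a + L + 0                           ≡⟨ +-identityʳ (a + L) ⟩
    a + L                               ∎
    where open ≡-Reasoning

  M≡ : M k n ≡ a + L
  M≡ = trans (cong (λ m → suc k * m ∸ 2) n∸k≡)
             (cong (_∸ 2) (solve 2 (λ k′ L → (con 2 :+ k′) :* (con 1 :+ L) := con 2 :+ ((k′ :* (con 1 :+ L) :+ L) :+ L)) refl k′ L))

  ν-range : ∀ j → k + j ≤ n ∸ 2 ⇔ suc j < suc L
  ν-range j = mk⇔ (s≤s ∘ Equivalence.from shifted) (Equivalence.to shifted ∘ ≤-pred)
    where
    shifted : suc j ≤ L ⇔ k + j ≤ k′ + L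
    shifted = ≤-⇔-shift k′ 0 (trans (+-suc k′ j) (sym (+-identityʳ (k + j)))) (sym (+-identityʳ (k′ + L)))

  binomial-top : ∀ {m} i → m ≡ suc L → i ≤ L → L + k′ * m + (m ∸ 1 ∸ i) ≡ k * m + m ∸ 2 ∸ i
  binomial-top i refl i≤L = sym (begin
    k * suc L + suc L ∸ 2 ∸ i       ≡⟨ cong (λ e → e ∸ 2 ∸ i) (solve 2 (λ k′ L → (con 1 :+ k′) :* (con 1 :+ L) :+ (con 1 :+ L)
                                                                         := con 2 :+ ((L :+ k′ :* (con 1 :+ L)) :+ L)) refl k′ L) ⟩
    (L + k′ * suc L) + L ∸ i        ≡⟨ +-∸-assoc (L + k′ * suc L) i≤L ⟩
    L + k′ * suc L + (L ∸ i)        ∎)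
    where open ≡-Reasoning

theorem3p20 : (k n i : ℕ) → 1 ≤ k → k < n → i ≤ n ∸ k ∸ 1 →
    Σ ℕ (λ N → Σ (Fin N → Data k n i) (λ f →
      Injective _≡_ _≡_ f
      × (∀ x → IsDiagram k n i x ⇔ ∃ (λ y → f y ≡ x))
      × (n ∸ k) * N ≡ (n ∸ k) ^ i * ((k * (n ∸ k) + (n ∸ k) ∸ 2 ∸ i) C (n ∸ k ∸ 1 ∸ i))))
theorem3p20 (suc k′) n i _ k<n i≤ with m≤n⇒∃[o]m+o≡n k<n
... | L , refl = diagram-enumeration n∸k≡ i+g≡L T-inner T-last μ≡ ν-range (binomial-top i n∸k≡ i≤L)
  where
  open CarThresholds k′ L
  g≡ : n ∸ suc k′ ∸ 1 ∸ i ≡ L ∸ i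
  g≡ = cong (λ m → m ∸ 1 ∸ i) n∸k≡
  i≤L : i ≤ L
  i≤L = subst (λ m → i ≤ m ∸ 1) n∸k≡ i≤
  i+g≡L : i + (n ∸ suc k′ ∸ 1 ∸ i) ≡ L
  i+g≡L = trans (cong (i +_) g≡) (m+[n∸m]≡n i≤L)
  μ≡ : M (suc k′) n ∸ i ≡ k′ * suc L + L + (n ∸ suc k′ ∸ 1 ∸ i)
  μ≡ = trans (cong (_∸ i) M≡) (trans (+-∸-assoc _ i≤L) (cong (k′ * suc L + L +_) (sym g≡)))
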